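{- For every simplicial complex $X$, $\theta(X)\leq k(X)$, where $k(X)$ is the maximum size of a set in $S(X)$.
   Context: A simplicial complex $X$ on a finite set $V$ is a family of subsets of $V$ closed under taking subsets; its vertices are those $v$ with $\{v\}\in X$, and its facets are its inclusion-maximal faces. For a vertex $v$, $\mathrm{del}(X;v)=\{S\in X:v\notin S\}$, $\mathrm{lk}(X;v)=\{T\in X:v\notin T,\ T\cup\{v\}\in X\}$; $v$ is a cone vertex if $\mathrm{lk}(X;v)=\mathrm{del}(X;v)$, and $V(X)^\circ$ is the set of non-cone vertices. Theta-number: $\theta(X)=0$ if $V(X)^\circ=\emptyset$, otherwise $\theta(X)=\min_{v\in V(X)^\circ}\max\{\theta(\mathrm{del}(X;v)),\theta(\mathrm{lk}(X;v))+1\}$. $S(X)$ is the collection of ordered sets $\{x_1,\dots,x_k\}$ of vertices of $X$ for which there exist facets $A_1,\dots,A_{k+1}$ of $X$ with $x_i\notin A_i$ for each $1\le i\le k$ and $x_i\in A_j$ for all $1\le i<j\le k+1$. -}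

module Defs where

open import Data.Nat using (ℕ; zero; suc; _⊔_; _⊓_; _<_)
open import Data.Bool using (Bool; true; false; _∧_; not; if_then_else_)
open import Data.Bool.Properties using (_≟_)
open import Data.Fin using (Fin; inject₁; toℕ)
open import Data.Fin.Subset using (Subset; ⊥; ⁅_⁆; _∪_; _⊆_; _∈_; _∉_)
open import Data.List using (List; []; _∷_; map; filterᵇ; foldr; _++_; allFin)
open import Data.Vec using (Vec; lookup) renaming ([] to []ᵛ; _∷_ to _∷ᵛ_)
open import Data.Product using (Σ; _×_; ∃)
open import Relation.Binary.PropositionalEquality using (_≡_)
open import Relation.Nullary.Decidable using (⌊_⌋)
open import Function.Definitions using (Injective)

Family : ℕ → Set
Family n = Subset n → Bool

IsSimplicialComplex : ∀ {n} → Family n → Set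
IsSimplicialComplex {n} X = ∀ (S T : Subset n) → T ⊆ S → X S ≡ true → X T ≡ true

_∈ᵇ_ : ∀ {n} → Fin n → Subset n → Bool
v ∈ᵇ S = lookup S v

allSubsets : ∀ n → List (Subset n)
allSubsets zero = []ᵛ ∷ []
allSubsets (suc n) = map (true ∷ᵛ_) (allSubsets n) ++ map (false ∷ᵛ_) (allSubsets n)

allᵇ : ∀ {A : Set} → (A → Bool) → List A → Bool
allᵇ p = foldr (λ a b → p a ∧ b) true

del : ∀ {n} → Family n → Fin n → Family n
del X v S = X S ∧ not (v ∈ᵇ S)

lk : ∀ {n} → Family n → Fin n → Family n
lk X v T = X T ∧ (not (v ∈ᵇ T) ∧ X (T ∪ ⁅ v ⁆))

isVertexᵇ : ∀ {n} → Family n → Fin n → Bool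
isVertexᵇ X v = X ⁅ v ⁆

isConeᵇ : ∀ {n} → Family n → Fin n → Bool
isConeᵇ {n} X v = allᵇ (λ S → ⌊ lk X v S ≟ del X v S ⌋) (allSubsets n)

nonConeVertexᵇ : ∀ {n} → Family n → Fin n → Bool
nonConeVertexᵇ X v = isVertexᵇ X v ∧ not (isConeᵇ X v)

-- minimum of a list; 0 for the empty list
minList : List ℕ → ℕ
minList [] = 0
minList (x ∷ xs) = foldr _⊓_ x xs

θ-fuel : ∀ {n} → ℕ → Family n → ℕ
θ-fuel zero X = 0
θ-fuel {n} (suc f) X =
  minList (map (λ v → θ-fuel f (del X v) ⊔ suc (θ-fuel f (lk X v)))
               (filterᵇ (nonConeVertexᵇ X) (allFin n)))

-- Each recursive step removes the vertex v from the
-- vertex set, and X has at most n vertices, so fuel n suffices: after n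
-- steps there are no vertices left (hence V° = ∅ and θ = 0 anyway).
θ : ∀ {n} → Family n → ℕ
θ {n} X = θ-fuel n X

IsFacet : ∀ {n} → Family n → Subset n → Set
IsFacet {n} X A = X A ≡ true × (∀ (B : Subset n) → X B ≡ true → A ⊆ B → B ≡ A)

IsVertex : ∀ {n} → Family n → Fin n → Set
IsVertex X v = X ⁅ v ⁆ ≡ true

-- The ordered set {x_1,…,x_k} (x : Fin k → Fin n, distinct vertices)
-- belongs to S(X): there are facets A_1,…,A_{k+1} with x_i ∉ A_i and
-- x_i ∈ A_j for i < j.  (Indices shifted to start at 0.)
InS : ∀ {n} → Family n → (k : ℕ) → (Fin k → Fin n) → Set
InS {n} X k x =
  Injective _≡_ _≡_ x ×
  (∀ i → IsVertex X (x i)) ×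
  Σ (Fin (suc k) → Subset n) λ A →
    (∀ j → IsFacet X (A j)) ×
    (∀ i → x i ∉ A (inject₁ i)) ×
    (∀ (i : Fin k) (j : Fin (suc k)) → toℕ i < toℕ j → x i ∈ A j)

IsMaxSizeInS : ∀ {n} → Family n → ℕ → Set
IsMaxSizeInS X m =
  (∃ λ x → InS X m x) × (∀ k x → InS X k x → k Data.Nat.≤ m)

{-# OPTIONS --safe #-}

-- We show that θ-fuel f X is bounded by the size of some member of S(X),
-- following the recursion defining θ.  Fix a non-cone vertex v.  Every facet
-- of del(X;v) is a face of X which extends to a facet of X by at most v, so
-- members of S(del(X;v)) are members of S(X).  Every facet B of lk(X;v) gives
-- the facet B ∪ {v} of X, and since v is not a cone vertex some facet F of X
-- misses v; hence a member {x₁,…,xₖ} of S(lk(X;v)) with facets B₁,…,Bₖ₊₁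
-- yields the member {v,x₁,…,xₖ} of S(X) with facets F, B₁∪{v}, …, Bₖ₊₁∪{v}.
-- When there is no non-cone vertex, the empty sequence with any facet of X
-- (which exists since ∅ ∈ X) witnesses the bound 0.

module Submission where

open import Defs
open import Data.Nat using (ℕ; _≤_)
open import Data.Bool using (true)
open import Data.Fin.Subset using (⊥)
open import Relation.Binary.PropositionalEquality using (_≡_)

open import Data.Nat using (zero; suc; _<_; _⊔_; _+_; s≤s; z≤n; _≤?_)
open import Data.Nat.Properties
  using (≤-refl; ≤-trans; ≤-antisym; ≤-reflexive; <⇒≤; ≰⇒>; ⊔-lub; m⊓n≤n; +-suc; +-monoʳ-≤; m≤m+n)
open import Data.Bool using (Bool; false; _∧_; not; T?)
open import Data.Bool.Properties using (T-≡) renaming (_≟_ to _≟ᵇ_)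
open import Data.Fin using (Fin; zero; suc; inject₁; toℕ)
open import Data.Fin.Properties using (any?) renaming (_≟_ to _≟ᶠ_)
open import Data.Fin.Subset using (Subset; ⁅_⁆; _∪_; _⊆_; _∈_; _∉_; ∣_∣)
open import Data.Fin.Subset.Properties
  using (_∈?_; ⊆-refl; ⊆-antisym; p⊆p∪q; x∈p∪q⁻; x∈p∪q⁺; x∈⁅x⁆; x∈⁅y⁆⇒x≡y; x∉⁅y⁆⇒x≢y;
         ∉⊥; ∈⊤; ∣p∣≤n; ∣p∣≡n⇒p≡⊤; p⊂q⇒∣p∣<∣q∣)
open import Data.List using ([]; _∷_; map; filterᵇ; allFin)
open import Data.List.Relation.Unary.All using (_∷_)
open import Data.List.Relation.Unary.All.Properties using (all-filter)
open import Data.Vec using (lookup)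
open import Data.Vec.Properties using (lookup⇒[]=; []=⇒lookup)
open import Data.Product using (_×_; _,_; proj₁; proj₂; ∃-syntax)
open import Data.Sum using (inj₁; inj₂)
open import Data.Empty using (⊥-elim)
open import Function using (_∘_)
open import Function.Bundles using (Equivalence)
open import Function.Definitions using (Injective)
open import Relation.Binary.PropositionalEquality using (refl; sym; trans; subst; cong; _≢_)
open import Relation.Nullary using (yes; no; ¬?)
open import Relation.Nullary.Decidable using (⌊_⌋; _×-dec_)

private
  variable
    n : ℕ
    X : Family n
    S T B : Subset n
    u v : Fin n

∧-true⁻ : ∀ {a b} → a ∧ b ≡ true → a ≡ true × b ≡ true
∧-true⁻ {true} {true} _ = refl , refl

not-true⁻ : ∀ {b} → not b ≡ true → b ≡ false
not-true⁻ {false} _ = refl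

∉⇒∈ᵇ≡false : v ∉ S → v ∈ᵇ S ≡ false
∉⇒∈ᵇ≡false {v = v} {S} v∉S with lookup S v in eq
... | true  = ⊥-elim (v∉S (lookup⇒[]= v S eq))
... | false = refl

∈ᵇ≡false⇒∉ : v ∈ᵇ S ≡ false → v ∉ S
∈ᵇ≡false⇒∉ eq v∈S with trans (sym ([]=⇒lookup v∈S)) eq
... | ()

del-true⁺ : ∀ X → X S ≡ true → v ∉ S → del X v S ≡ true
del-true⁺ X XS v∉S rewrite XS | ∉⇒∈ᵇ≡false v∉S = refl

del-true⁻ : ∀ X → del X v S ≡ true → X S ≡ true × v ∉ S
del-true⁻ X h with ∧-true⁻ h
... | XS , v∉S = XS , ∈ᵇ≡false⇒∉ (not-true⁻ v∉S)

lk-true⁺ : ∀ X → X S ≡ true → v ∉ S → X (S ∪ ⁅ v ⁆) ≡ true → lk X v S ≡ true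
lk-true⁺ X XS v∉S XSv rewrite XS | ∉⇒∈ᵇ≡false v∉S | XSv = refl

lk-true⁻ : ∀ X → lk X v S ≡ true → X S ≡ true × v ∉ S × X (S ∪ ⁅ v ⁆) ≡ true
lk-true⁻ X h with ∧-true⁻ h
... | XS , rest with ∧-true⁻ rest
... | v∉S , XSv = XS , ∈ᵇ≡false⇒∉ (not-true⁻ v∉S) , XSv

∪-monoˡ-⊆ : T ⊆ S → T ∪ B ⊆ S ∪ B
∪-monoˡ-⊆ {T = T} {B = B} T⊆S x∈ with x∈p∪q⁻ T B x∈
... | inj₁ x∈T = x∈p∪q⁺ (inj₁ (T⊆S x∈T))
... | inj₂ x∈B = x∈p∪q⁺ (inj₂ x∈B)

∪⁅⁆-⊆ : B ⊆ S → u ∈ S → B ∪ ⁅ u ⁆ ⊆ S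
∪⁅⁆-⊆ {B = B} {S} {u} B⊆S u∈S x∈ with x∈p∪q⁻ B ⁅ u ⁆ x∈
... | inj₁ x∈B = B⊆S x∈B
... | inj₂ x∈u = subst (_∈ S) (sym (x∈⁅y⁆⇒x≡y u x∈u)) u∈S

x∈p∪⁅x⁆ : ∀ (p : Subset n) x → x ∈ p ∪ ⁅ x ⁆
x∈p∪⁅x⁆ p x = x∈p∪q⁺ (inj₂ (x∈⁅x⁆ x))

x∉p∪⁅y⁆⁺ : v ∉ B → v ≢ u → v ∉ B ∪ ⁅ u ⁆
x∉p∪⁅y⁆⁺ {B = B} {u = u} v∉B v≢u v∈ with x∈p∪q⁻ B ⁅ u ⁆ v∈
... | inj₁ v∈B = v∉B v∈B
... | inj₂ v∈u = v≢u (x∈⁅y⁆⇒x≡y u v∈u)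

x∉p∪⁅y⁆⁻ : v ∉ B ∪ ⁅ u ⁆ → v ∉ B × v ≢ u
x∉p∪⁅y⁆⁻ {B = B} v∉ = (v∉ ∘ p⊆p∪q _) , λ { refl → v∉ (x∈p∪⁅x⁆ B _) }

∪⁅⁆-swap-⊆ : (B ∪ ⁅ u ⁆) ∪ ⁅ v ⁆ ⊆ (B ∪ ⁅ v ⁆) ∪ ⁅ u ⁆
∪⁅⁆-swap-⊆ {B = B} {v = v} = ∪⁅⁆-⊆ (∪-monoˡ-⊆ (p⊆p∪q _)) (p⊆p∪q _ (x∈p∪⁅x⁆ B v))

Unextendable : Family n → Subset n → Set
Unextendable X A = ∀ i → i ∉ A → X (A ∪ ⁅ i ⁆) ≢ true

unextendable⇒facet : IsSimplicialComplex X → X S ≡ true → Unextendable X S → IsFacet X S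
unextendable⇒facet {X = X} {S = S} cx XS unext = XS , λ B XB S⊆B → ⊆-antisym (B⊆S XB S⊆B) S⊆B
  where
  B⊆S : ∀ {B} → X B ≡ true → S ⊆ B → B ⊆ S
  B⊆S {B} XB S⊆B {i} i∈B with i ∈? S
  ... | yes i∈S = i∈S
  ... | no  i∉S = ⊥-elim (unext i i∉S (cx B (S ∪ ⁅ i ⁆) (∪⁅⁆-⊆ S⊆B i∈B) XB))

facet⇒unextendable : IsFacet X S → Unextendable X S
facet⇒unextendable {S = S} (_ , maximal) i i∉S XSi =
  i∉S (subst (i ∈_) (maximal _ XSi (p⊆p∪q _)) (x∈p∪⁅x⁆ S i))

extend-to-facet : ∀ {n} {X : Family n} {S} → IsSimplicialComplex X → X S ≡ true →
                  ∃[ F ] S ⊆ F × IsFacet X F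
extend-to-facet {n} {X} cx = go n _ (m≤m+n n _)
  where
  -- d bounds the number of vertices still missing from S
  go : ∀ d S → n ≤ d + ∣ S ∣ → X S ≡ true → ∃[ F ] S ⊆ F × IsFacet X F
  go zero S full XS = S , ⊆-refl , unextendable⇒facet cx XS λ i i∉S _ →
    i∉S (subst (i ∈_) (sym (∣p∣≡n⇒p≡⊤ (≤-antisym (∣p∣≤n S) full))) ∈⊤)
  go (suc d) S bound XS with any? (λ i → ¬? (i ∈? S) ×-dec (X (S ∪ ⁅ i ⁆) ≟ᵇ true))
  ... | no unext = S , ⊆-refl , unextendable⇒facet cx XS λ i i∉S XSi → unext (i , i∉S , XSi)
  ... | yes (i , i∉S , XSi) with go d (S ∪ ⁅ i ⁆) bound′ XSi
    where
    bound′ : n ≤ d + ∣ S ∪ ⁅ i ⁆ ∣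
    bound′ = ≤-trans bound (≤-trans (≤-reflexive (sym (+-suc d ∣ S ∣)))
               (+-monoʳ-≤ d (p⊂q⇒∣p∣<∣q∣ (p⊆p∪q _ , i , x∈p∪⁅x⁆ S i , i∉S))))
  ... | F , S∪i⊆F , facetF = F , S∪i⊆F ∘ p⊆p∪q _ , facetF

allᵇ≡false⇒∃ : ∀ {A : Set} (p : A → Bool) xs → allᵇ p xs ≡ false → ∃[ a ] p a ≡ false
allᵇ≡false⇒∃ p []       ()
allᵇ≡false⇒∃ p (a ∷ xs) h with p a in eq
... | false = a , eq
... | true  = allᵇ≡false⇒∃ p xs h

-- With a = X S, b = v ∈ᵇ S, c = X (S ∪ ⁅ v ⁆): lk X v and del X v differ at S
-- only if S ∈ X, v ∉ S and S ∪ {v} ∉ X.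
lk≢del⇒obstruction : ∀ a b c → ⌊ (a ∧ (not b ∧ c)) ≟ᵇ (a ∧ not b) ⌋ ≡ false →
                     a ≡ true × b ≡ false × c ≡ false
lk≢del⇒obstruction true  false false _ = refl , refl , refl
lk≢del⇒obstruction true  false true  ()
lk≢del⇒obstruction true  true  _     ()
lk≢del⇒obstruction false _     _     ()

nonCone⇒facet-avoiding : IsSimplicialComplex X → nonConeVertexᵇ X v ≡ true →
                         IsVertex X v × ∃[ F ] IsFacet X F × v ∉ F
nonCone⇒facet-avoiding {X = X} {v = v} cx h with ∧-true⁻ h
... | Xv , notCone with allᵇ≡false⇒∃ _ (allSubsets _) (not-true⁻ notCone)
... | S , differ with lk≢del⇒obstruction (X S) (v ∈ᵇ S) (X (S ∪ ⁅ v ⁆)) differ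
... | XS , v∉S , XSv≡false with extend-to-facet cx XS
... | F , S⊆F , facetF = Xv , F , facetF , v∉F
  where
  v∉F : v ∉ F
  v∉F v∈F with trans (sym (cx F _ (∪⁅⁆-⊆ S⊆F v∈F) (proj₁ facetF))) XSv≡false
  ... | ()

del-isSimplicialComplex : IsSimplicialComplex X → IsSimplicialComplex (del X v)
del-isSimplicialComplex {X = X} cx S T T⊆S h with del-true⁻ X h
... | XS , v∉S = del-true⁺ X (cx S T T⊆S XS) (v∉S ∘ T⊆S)

lk-isSimplicialComplex : IsSimplicialComplex X → IsSimplicialComplex (lk X v)
lk-isSimplicialComplex {X = X} cx S T T⊆S h with lk-true⁻ X h
... | XS , v∉S , XSv = lk-true⁺ X (cx S T T⊆S XS) (v∉S ∘ T⊆S) (cx _ _ (∪-monoˡ-⊆ T⊆S) XSv)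

lk-∅ : IsSimplicialComplex X → X ⊥ ≡ true → IsVertex X v → lk X v ⊥ ≡ true
lk-∅ {X = X} cx X∅ Xv = lk-true⁺ X X∅ ∉⊥ (cx _ _ (∪⁅⁆-⊆ (⊥-elim ∘ ∉⊥) (x∈⁅x⁆ _)) Xv)

del-facet⇒facet : IsSimplicialComplex X → IsFacet (del X v) B →
                  ∃[ A ] IsFacet X A × B ⊆ A × A ⊆ B ∪ ⁅ v ⁆
del-facet⇒facet {X = X} {v = v} {B = B} cx facetB
  with del-true⁻ X (proj₁ facetB) | X (B ∪ ⁅ v ⁆) in XBv
... | _  , v∉B | true  = B ∪ ⁅ v ⁆ , unextendable⇒facet cx XBv unext , p⊆p∪q _ , ⊆-refl
  where
  unext : Unextendable X (B ∪ ⁅ v ⁆)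
  unext i i∉ XBvi with x∉p∪⁅y⁆⁻ i∉
  ... | i∉B , i≢v = facet⇒unextendable facetB i i∉B
    (del-true⁺ X (cx _ _ (∪-monoˡ-⊆ (p⊆p∪q _)) XBvi) (x∉p∪⁅y⁆⁺ v∉B (i≢v ∘ sym)))
... | XB , v∉B | false = B , unextendable⇒facet cx XB unext , ⊆-refl , p⊆p∪q _
  where
  unext : Unextendable X B
  unext i i∉B XBi with i ≟ᶠ v
  ... | yes refl with trans (sym XBv) XBi
  ...   | ()
  unext i i∉B XBi | no i≢v =
    facet⇒unextendable facetB i i∉B (del-true⁺ X XBi (x∉p∪⁅y⁆⁺ v∉B (i≢v ∘ sym)))

InS-del⇒InS : ∀ {k x} → IsSimplicialComplex X → InS (del X v) k x → InS X k x
InS-del⇒InS {X = X} {v = v} {k} {x} cx (injective , vertex , B , facetB , x∉B , x∈B) =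
  injective , proj₁ ∘ vertex′ , A , proj₁ ∘ proj₂ ∘ facetA , x∉A , λ i j i<j → B⊆A j (x∈B i j i<j)
  where
  vertex′ : ∀ i → X ⁅ x i ⁆ ≡ true × v ∉ ⁅ x i ⁆
  vertex′ i = del-true⁻ X (vertex i)
  facetA : ∀ j → ∃[ A ] IsFacet X A × B j ⊆ A × A ⊆ B j ∪ ⁅ v ⁆
  facetA j = del-facet⇒facet cx (facetB j)
  A : Fin (suc k) → Subset _
  A = proj₁ ∘ facetA
  B⊆A : ∀ j → B j ⊆ A j
  B⊆A j = proj₁ (proj₂ (proj₂ (facetA j)))
  A⊆B∪v : ∀ j → A j ⊆ B j ∪ ⁅ v ⁆
  A⊆B∪v j = proj₂ (proj₂ (proj₂ (facetA j)))
  x∉A : ∀ i → x i ∉ A (inject₁ i)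
  x∉A i xi∈A with x∈p∪q⁻ (B (inject₁ i)) ⁅ v ⁆ (A⊆B∪v (inject₁ i) xi∈A)
  ... | inj₁ xi∈B = x∉B i xi∈B
  ... | inj₂ xi∈v = proj₂ (vertex′ i) (subst (_∈ ⁅ x i ⁆) (x∈⁅y⁆⇒x≡y v xi∈v) (x∈⁅x⁆ (x i)))

lk-facet⇒facet : IsSimplicialComplex X → IsFacet (lk X v) B → IsFacet X (B ∪ ⁅ v ⁆)
lk-facet⇒facet {X = X} {v = v} {B = B} cx facetB with lk-true⁻ X (proj₁ facetB)
... | _ , v∉B , XBv = unextendable⇒facet cx XBv unext
  where
  unext : Unextendable X (B ∪ ⁅ v ⁆)
  unext i i∉ XBvi with x∉p∪⁅y⁆⁻ i∉
  ... | i∉B , i≢v = facet⇒unextendable facetB i i∉B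
    (lk-true⁺ X (cx _ _ (∪-monoˡ-⊆ (p⊆p∪q _)) XBvi) (x∉p∪⁅y⁆⁺ v∉B (i≢v ∘ sym))
                (cx _ _ ∪⁅⁆-swap-⊆ XBvi))

InS-lk⇒InS-suc : ∀ {k x} F → IsSimplicialComplex X → IsVertex X v → IsFacet X F → v ∉ F →
                 InS (lk X v) k x → ∃[ y ] InS X (suc k) y
InS-lk⇒InS-suc {X = X} {v = v} {k} {x} F cx Xv facetF v∉F
               (injective , vertex , B , facetB , x∉B , x∈B) =
  y , injective′ , vertex′ , A , facetA , y∉A , y∈A
  where
  v≢x : ∀ i → v ≢ x i
  v≢x i = x∉⁅y⁆⇒x≢y (proj₁ (proj₂ (lk-true⁻ X (vertex i))))
  y : Fin (suc k) → Fin _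
  y zero    = v
  y (suc i) = x i
  injective′ : Injective _≡_ _≡_ y
  injective′ {zero}  {zero}  _  = refl
  injective′ {zero}  {suc j} eq = ⊥-elim (v≢x j eq)
  injective′ {suc i} {zero}  eq = ⊥-elim (v≢x i (sym eq))
  injective′ {suc i} {suc j} eq = cong suc (injective eq)
  vertex′ : ∀ i → IsVertex X (y i)
  vertex′ zero    = Xv
  vertex′ (suc i) = proj₁ (lk-true⁻ X (vertex i))
  A : Fin (suc (suc k)) → Subset _
  A zero    = F
  A (suc j) = B j ∪ ⁅ v ⁆
  facetA : ∀ j → IsFacet X (A j)
  facetA zero    = facetF
  facetA (suc j) = lk-facet⇒facet cx (facetB j)
  y∉A : ∀ i → y i ∉ A (inject₁ i)
  y∉A zero          = v∉F
  y∉A (suc i) xi∈A with x∈p∪q⁻ (B (inject₁ i)) ⁅ v ⁆ xi∈A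
  ... | inj₁ xi∈B = x∉B i xi∈B
  ... | inj₂ xi∈v = v≢x i (sym (x∈⁅y⁆⇒x≡y v xi∈v))
  y∈A : ∀ i j → toℕ i < toℕ j → y i ∈ A j
  y∈A zero    (suc j) _         = x∈p∪⁅x⁆ (B j) v
  y∈A (suc i) (suc j) (s≤s i<j) = p⊆p∪q _ (x∈B i j i<j)

InS-size≥ : Family n → ℕ → Set
InS-size≥ X t = ∃[ k ] t ≤ k × ∃[ x ] InS X k x

InS-size≥-antitone : ∀ {s t} → s ≤ t → InS-size≥ X t → InS-size≥ X s
InS-size≥-antitone s≤t (k , t≤k , member) = k , ≤-trans s≤t t≤k , member

InS-size≥-⊔ : ∀ {s t} → InS-size≥ X s → InS-size≥ X t → InS-size≥ X (s ⊔ t)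
InS-size≥-⊔ (k , s≤k , mk) (l , t≤l , ml) with k ≤? l
... | yes k≤l = l , ⊔-lub (≤-trans s≤k k≤l) t≤l , ml
... | no  k≰l = k , ⊔-lub s≤k (≤-trans t≤l (<⇒≤ (≰⇒> k≰l))) , mk

InS-size≥-zero : IsSimplicialComplex X → X ⊥ ≡ true → InS-size≥ X 0
InS-size≥-zero cx X∅ with extend-to-facet cx X∅
... | F , _ , facetF =
  0 , z≤n , (λ ()) , (λ { {()} }) , (λ ()) , (λ _ → F) , (λ _ → facetF) , (λ ()) , (λ ())

minList-≤-head : ∀ x xs → minList (x ∷ xs) ≤ x
minList-≤-head x []       = ≤-refl
minList-≤-head x (y ∷ ys) = ≤-trans (m⊓n≤n y _) (minList-≤-head x ys)

θ-fuel-bounded : ∀ {n} {X : Family n} f → IsSimplicialComplex X → X ⊥ ≡ true →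
                 InS-size≥ X (θ-fuel f X)
θ-fuel-bounded zero cx X∅ = InS-size≥-zero cx X∅
θ-fuel-bounded {n} {X} (suc f) cx X∅
  with filterᵇ (nonConeVertexᵇ X) (allFin n) | all-filter (T? ∘ nonConeVertexᵇ X) (allFin n)
... | []     | _        = InS-size≥-zero cx X∅
... | v ∷ vs | nonCone ∷ _ =
  InS-size≥-antitone (minList-≤-head _ (map _ vs)) (step (Equivalence.to T-≡ nonCone))
  where
  step : nonConeVertexᵇ X v ≡ true → InS-size≥ X (θ-fuel f (del X v) ⊔ suc (θ-fuel f (lk X v)))
  step h with nonCone⇒facet-avoiding cx h
  ... | Xv , F , facetF , v∉F
    with θ-fuel-bounded f (del-isSimplicialComplex cx) (del-true⁺ X X∅ ∉⊥)
       | θ-fuel-bounded f (lk-isSimplicialComplex cx) (lk-∅ cx X∅ Xv)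
  ... | k , d≤k , x , xInDel | l , lk≤l , y , yInLk =
    InS-size≥-⊔ (k , d≤k , x , InS-del⇒InS cx xInDel)
                (suc l , s≤s lk≤l , InS-lk⇒InS-suc F cx Xv facetF v∉F yInLk)

corollary29 : ∀ (n : ℕ) (X : Family n) → IsSimplicialComplex X → X ⊥ ≡ true →
                  ∀ (m : ℕ) → IsMaxSizeInS X m → θ X ≤ m
corollary29 n X cx X∅ m (_ , maximal) with θ-fuel-bounded n cx X∅
... | k , θ≤k , x , xInS = ≤-trans θ≤k (maximal k x xInS)
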